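{- Let $f\in\mathbb{Z}[x]$ be an irreducible cubic polynomial with homogenisation $f(a,b)=b^3f(a/b)$, and let $\mathcal{P}_1$ be a finite set of primes containing all primes dividing the discriminant of $f$ and all primes dividing the coefficient of $a^3$ or of $b^3$ in $f(a,b)$. For $d\in\mathbb{N}$ let $\rho_1(d)$ be the number of $(a,b)\in(\mathbb{Z}/d\mathbb{Z})^2$ with $f(a,b)\equiv0\pmod d$. Then for every prime $p\notin\mathcal{P}_1$ and every $\alpha\in\mathbb{N}$, $$\rho_1(p^\alpha)\ll p^{\frac{4\alpha}{3}},$$ with an absolute implied constant. -}

module Defs where

open import Data.Nat as ℕ using (ℕ; zero; suc)
open import Data.Integer as ℤ using (ℤ; +_; -[1+_]; _+_; _*_; -_; _-_)
open import Data.Integer.Divisibility using (_∣_)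
import Data.Nat.Divisibility as ℕD
open import Data.List using (List; []; _∷_; length; filter; upTo; concatMap; map)
open import Data.Product using (_×_; _,_)
open import Relation.Nullary using (¬_)
open import Relation.Binary.PropositionalEquality using (_≡_)
open import Data.Sum using (_⊎_)

-- Polynomials in ℤ[x] as coefficient lists, lowest degree first.
Poly : Set
Poly = List ℤ

coeff : Poly → ℕ → ℤ
coeff []       _       = + 0
coeff (c ∷ cs) zero    = c
coeff (c ∷ cs) (suc n) = coeff cs n

scale : ℤ → Poly → Poly
scale c = map (c *_)

addP : Poly → Poly → Poly
addP []       q        = q
addP p        []       = p
addP (a ∷ p) (b ∷ q) = (a + b) ∷ addP p q

mulP : Poly → Poly → Poly
mulP []       q = []
mulP (a ∷ p)  q = addP (scale a q) (+ 0 ∷ mulP p q)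

-- equality of polynomials (coefficientwise; trailing zeros irrelevant)
_≈P_ : Poly → Poly → Set
p ≈P q = ∀ n → coeff p n ≡ coeff q n

IsUnitP : Poly → Set
IsUnitP p = (p ≈P (+ 1 ∷ [])) ⊎ (p ≈P (- + 1 ∷ []))

IrreducibleP : Poly → Set
IrreducibleP f =
  ¬ (f ≈P []) × ¬ IsUnitP f ×
  (∀ g h → f ≈P mulP g h → IsUnitP g ⊎ IsUnitP h)

record Cubic : Set where
  constructor cubic
  field
    c0 c1 c2 c3 : ℤ

open Cubic public

toPoly : Cubic → Poly
toPoly f = c0 f ∷ c1 f ∷ c2 f ∷ c3 f ∷ []

IsCubic : Cubic → Set
IsCubic f = ¬ (c3 f ≡ + 0)

disc : Cubic → ℤ
disc f =
  let a = c3 f ; b = c2 f ; c = c1 f ; d = c0 f in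
  b * b * c * c - + 4 * a * c * c * c - + 4 * b * b * b * d
    - + 27 * a * a * d * d + + 18 * a * b * c * d

-- homogenisation f(a,b) = b^3 f(a/b) = c3 a^3 + c2 a^2 b + c1 a b^2 + c0 b^3
homog : Cubic → ℤ → ℤ → ℤ
homog f a b =
  c3 f * a * a * a + c2 f * a * a * b + c1 f * a * b * b + c0 f * b * b * b

-- all pairs (a,b) with 0 ≤ a,b < d (representatives of (ℤ/dℤ)²)
pairs : ℕ → List (ℕ × ℕ)
pairs d = concatMap (λ a → map (λ b → (a , b)) (upTo d)) (upTo d)

ρ₁ : Cubic → ℕ → ℕ
ρ₁ f d = length (filter (λ ab → d ℕD.∣? ℤ.∣ homog f (+ Data.Product.proj₁ ab) (+ Data.Product.proj₂ ab) ∣) (pairs d))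

{-# OPTIONS --safe #-}
module Submission where

open import Defs

-- For p ∤ a, x ↦ f(a, x) is a cubic g whose leading coefficient c0 f and discriminant a⁶ disc f
-- are prime to p. Since ±disc g is a combination of g and g′, the roots of g mod p are simple, so
-- two roots mod p^(n+1) that agree mod p agree mod p^(n+1); and g has at most three roots mod p.
-- Hence each such a contributes at most 3 pairs. For p ∣ a, f(a, b) ≡ c0 b³ forces p ∣ b, and
-- f(pa, pb) = p³ f(a, b) together with periodicity mod pⁿ turns these pairs mod p^(n+3) into p⁴
-- copies of the pairs mod pⁿ. So ρ₁(p^(n+3)) ≤ p⁴ ρ₁(pⁿ) + 3(p − 1) p^(n+2), and induction in
-- steps of 3 gives ρ₁(p^α)³ ≤ 343 p^(4α).

module Congruences where

  open import Data.Nat as ℕ using (ℕ; zero; suc)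
  import Data.Nat.Properties as ℕₚ
  import Data.Nat.Divisibility as ℕᵈ
  open import Data.Nat.Primality using (Prime; euclidsLemma; prime⇒nonZero)
  open import Data.Integer as ℤ using (ℤ; +_; -_; _+_; _*_; _-_)
  open import Data.Integer.Properties using (abs-*; neg-involutive; +-inverseʳ; +-identityʳ; pos-+; pos-*)
  open import Data.Integer.Divisibility.Signed
  open import Data.Integer.Tactic.RingSolver using (solve-∀)
  open import Data.Sum as Sum using (_⊎_; inj₁; inj₂)
  open import Data.Empty using (⊥)
  open import Relation.Binary.PropositionalEquality
  open import Relation.Nullary using (¬_; contradiction)

  module _ {p : ℕ} (p-prime : Prime p) where

    euclidsLemmaᶻ : ∀ m n → + p ∣ m * n → + p ∣ m ⊎ + p ∣ n
    euclidsLemmaᶻ m n p∣m*n =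
      Sum.map (∣ᵤ⇒∣ {+ p} {m}) (∣ᵤ⇒∣ {+ p} {n})
        (euclidsLemma ℤ.∣ m ∣ ℤ.∣ n ∣ p-prime (subst (p ℕᵈ.∣_) (abs-* m n) (∣⇒∣ᵤ p∣m*n)))

    p∣m*n∧p∤m⇒p∣n : ∀ {m n} → + p ∣ m * n → ¬ + p ∣ m → + p ∣ n
    p∣m*n∧p∤m⇒p∣n {m} {n} p∣m*n p∤m with euclidsLemmaᶻ m n p∣m*n
    ... | inj₁ p∣m = contradiction p∣m p∤m
    ... | inj₂ p∣n = p∣n

    p∤m∧p∤n⇒p∤m*n : ∀ {m n} → ¬ + p ∣ m → ¬ + p ∣ n → ¬ + p ∣ m * n
    p∤m∧p∤n⇒p∤m*n p∤m p∤n p∣m*n = p∤n (p∣m*n∧p∤m⇒p∣n p∣m*n p∤m)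

    p∣cofactor : ∀ {m n d q} → m - n ≡ d * q → + p ∣ m → + p ∣ n → ¬ + p ∣ d → + p ∣ q
    p∣cofactor m-n≡d*q p∣m p∣n = p∣m*n∧p∤m⇒p∣n (subst (+ p ∣_) m-n≡d*q (∣m∣n⇒∣m-n p∣m p∣n))

    p∤n∧pᵏ∣m*n⇒pᵏ∣m : ∀ {m n} k → ¬ p ℕᵈ.∣ n → p ℕ.^ k ℕᵈ.∣ m ℕ.* n → p ℕ.^ k ℕᵈ.∣ m
    p∤n∧pᵏ∣m*n⇒pᵏ∣m zero _ _ = ℕᵈ.1∣ _
    p∤n∧pᵏ∣m*n⇒pᵏ∣m {m} {n} (suc k) p∤n pᵏ⁺¹∣m*n
      with euclidsLemma m n p-prime (ℕᵈ.∣-trans (ℕᵈ.m∣m*n (p ℕ.^ k)) pᵏ⁺¹∣m*n)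
    ... | inj₂ p∣n = contradiction p∣n p∤n
    ... | inj₁ (ℕᵈ.divides m′ refl) =
      subst (p ℕ.^ suc k ℕᵈ.∣_) (ℕₚ.*-comm p m′)
        (ℕᵈ.*-monoʳ-∣ p (p∤n∧pᵏ∣m*n⇒pᵏ∣m k p∤n (ℕᵈ.*-cancelˡ-∣ p pᵏ⁺¹∣p*m′*n)))
      where
      instance
        _ : ℕ.NonZero p
        _ = prime⇒nonZero p-prime
      pᵏ⁺¹∣p*m′*n : p ℕ.* p ℕ.^ k ℕᵈ.∣ p ℕ.* (m′ ℕ.* n)
      pᵏ⁺¹∣p*m′*n = subst (p ℕ.^ suc k ℕᵈ.∣_)
        (trans (cong (ℕ._* n) (ℕₚ.*-comm m′ p)) (ℕₚ.*-assoc p m′ n)) pᵏ⁺¹∣m*n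

  eval : Cubic → ℤ → ℤ
  eval g x = c3 g * x * x * x + c2 g * x * x + c1 g * x + c0 g

  eval′ : Cubic → ℤ → ℤ
  eval′ g x = + 3 * c3 g * x * x + + 2 * c2 g * x + c1 g

  Δ₁ : Cubic → ℤ → ℤ → ℤ
  Δ₁ g x y = c3 g * (x * x + x * y + y * y) + c2 g * (x + y) + c1 g

  Δ₂ : Cubic → ℤ → ℤ → ℤ → ℤ
  Δ₂ g x y z = c3 g * (x + y + z) + c2 g

  -- solve-∀ only sees through variables, so each identity is restated on the coefficients.
  eval-sub : ∀ g x y → eval g y - eval g x ≡ (y - x) * Δ₁ g x y
  eval-sub (cubic e0 e1 e2 e3) = identity e0 e1 e2 e3
    where
    identity : ∀ e0 e1 e2 e3 x y →
      (e3 * y * y * y + e2 * y * y + e1 * y + e0) - (e3 * x * x * x + e2 * x * x + e1 * x + e0)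
      ≡ (y - x) * (e3 * (x * x + x * y + y * y) + e2 * (x + y) + e1)
    identity = solve-∀

  Δ₁-sub : ∀ g x y z → Δ₁ g x z - Δ₁ g x y ≡ (z - y) * Δ₂ g x y z
  Δ₁-sub (cubic _ e1 e2 e3) = identity e1 e2 e3
    where
    identity : ∀ e1 e2 e3 x y z →
      (e3 * (x * x + x * z + z * z) + e2 * (x + z) + e1) - (e3 * (x * x + x * y + y * y) + e2 * (x + y) + e1)
      ≡ (z - y) * (e3 * (x + y + z) + e2)
    identity = solve-∀

  Δ₂-sub : ∀ g x y z w → Δ₂ g x y w - Δ₂ g x y z ≡ (w - z) * c3 g
  Δ₂-sub (cubic _ _ e2 e3) = identity e2 e3
    where
    identity : ∀ e2 e3 x y z w → (e3 * (x + y + w) + e2) - (e3 * (x + y + z) + e2) ≡ (w - z) * e3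
    identity = solve-∀

  Δ₁-diagonal : ∀ g x y → Δ₁ g x y - eval′ g x ≡ (y - x) * (c3 g * (y + + 2 * x) + c2 g)
  Δ₁-diagonal (cubic _ e1 e2 e3) = identity e1 e2 e3
    where
    identity : ∀ e1 e2 e3 x y →
      (e3 * (x * x + x * y + y * y) + e2 * (x + y) + e1) - (+ 3 * e3 * x * x + + 2 * e2 * x + e1)
      ≡ (y - x) * (e3 * (y + + 2 * x) + e2)
    identity = solve-∀

  -- Cofactors expressing the resultant of g and g′ as a combination of g and g′.
  resultant-cofactor₁ resultant-cofactor₂ : Cubic → ℤ → ℤ
  resultant-cofactor₁ (cubic e0 e1 e2 e3) x =
    + 4 * e2 * e2 * e2 - + 15 * e3 * e2 * e1 + + 6 * e3 * e2 * e2 * x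
      + + 27 * e3 * e3 * e0 - + 18 * e3 * e3 * e1 * x
  resultant-cofactor₂ (cubic e0 e1 e2 e3) x =
    - (e2 * e2 * e1) - + 2 * e2 * e2 * e2 * x + + 4 * e3 * e1 * e1 - + 3 * e3 * e2 * e0
      + + 7 * e3 * e2 * e1 * x - + 2 * e3 * e2 * e2 * x * x - + 9 * e3 * e3 * e0 * x
      + + 6 * e3 * e3 * e1 * x * x

  resultant-identity : ∀ g x →
    resultant-cofactor₁ g x * eval g x + resultant-cofactor₂ g x * eval′ g x ≡ - disc g
  resultant-identity (cubic e0 e1 e2 e3) = identity e0 e1 e2 e3
    where
    identity : ∀ e0 e1 e2 e3 x →
      (+ 4 * e2 * e2 * e2 - + 15 * e3 * e2 * e1 + + 6 * e3 * e2 * e2 * x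
        + + 27 * e3 * e3 * e0 - + 18 * e3 * e3 * e1 * x)
        * (e3 * x * x * x + e2 * x * x + e1 * x + e0)
      + (- (e2 * e2 * e1) - + 2 * e2 * e2 * e2 * x + + 4 * e3 * e1 * e1 - + 3 * e3 * e2 * e0
          + + 7 * e3 * e2 * e1 * x - + 2 * e3 * e2 * e2 * x * x - + 9 * e3 * e3 * e0 * x
          + + 6 * e3 * e3 * e1 * x * x)
        * (+ 3 * e3 * x * x + + 2 * e2 * x + e1)
      ≡ - (e2 * e2 * e1 * e1 - + 4 * e3 * e1 * e1 * e1 - + 4 * e2 * e2 * e2 * e0
            - + 27 * e3 * e3 * e0 * e0 + + 18 * e3 * e2 * e1 * e0)
    identity = solve-∀

  module _ (g : Cubic) {p : ℕ} (p-prime : Prime p) where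

    no-double-root : ¬ + p ∣ disc g → ∀ {x} → + p ∣ eval g x → ¬ + p ∣ eval′ g x
    no-double-root p∤disc {x} p∣g p∣g′ = p∤disc (subst (+ p ∣_) (neg-involutive (disc g)) (∣m⇒∣-m p∣-disc))
      where
      p∣-disc : + p ∣ - disc g
      p∣-disc = subst (+ p ∣_) (resultant-identity g x)
        (∣m∣n⇒∣m+n (∣n⇒∣m*n (resultant-cofactor₁ g x) p∣g) (∣n⇒∣m*n (resultant-cofactor₂ g x) p∣g′))

    p∤Δ₁-at-root : ¬ + p ∣ disc g → ∀ {x y} → + p ∣ eval g x → + p ∣ y - x → ¬ + p ∣ Δ₁ g x y
    p∤Δ₁-at-root p∤disc {x} {y} p∣g p∣y-x p∣Δ₁ =
      no-double-root p∤disc p∣g (subst (+ p ∣_) (neg-involutive (eval′ g x)) (∣m⇒∣-m p∣-g′))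
      where
      p∣-g′ : + p ∣ - eval′ g x
      p∣-g′ = ∣m+n∣m⇒∣n (subst (+ p ∣_) (sym (Δ₁-diagonal g x y)) (∣m⇒∣m*n _ p∣y-x)) p∣Δ₁

    root-lifts-uniquely : ¬ + p ∣ disc g → ∀ n {x y} →
      + (p ℕ.^ suc n) ∣ eval g x → + (p ℕ.^ suc n) ∣ eval g y → + p ∣ y - x →
      + (p ℕ.^ suc n) ∣ y - x
    root-lifts-uniquely p∤disc n {x} {y} pⁿ∣gx pⁿ∣gy p∣y-x =
      ∣ᵤ⇒∣ {+ (p ℕ.^ suc n)} {y - x} (p∤n∧pᵏ∣m*n⇒pᵏ∣m p-prime (suc n) p∤Δ₁
        (subst (p ℕ.^ suc n ℕᵈ.∣_) (abs-* (y - x) (Δ₁ g x y)) (∣⇒∣ᵤ pⁿ∣[y-x]*Δ₁)))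
      where
      p∣gx : + p ∣ eval g x
      p∣gx = ∣-trans (∣ᵤ⇒∣ {+ p} {+ (p ℕ.^ suc n)} (ℕᵈ.m∣m*n (p ℕ.^ n))) pⁿ∣gx
      p∤Δ₁ : ¬ p ℕᵈ.∣ ℤ.∣ Δ₁ g x y ∣
      p∤Δ₁ p∣Δ₁ = p∤Δ₁-at-root p∤disc p∣gx p∣y-x (∣ᵤ⇒∣ {+ p} {Δ₁ g x y} p∣Δ₁)
      pⁿ∣[y-x]*Δ₁ : + (p ℕ.^ suc n) ∣ (y - x) * Δ₁ g x y
      pⁿ∣[y-x]*Δ₁ = subst (+ (p ℕ.^ suc n) ∣_) (eval-sub g x y) (∣m∣n⇒∣m-n pⁿ∣gy pⁿ∣gx)

    no-four-roots : ¬ + p ∣ c3 g → ∀ {x y z w} →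
      + p ∣ eval g x → + p ∣ eval g y → + p ∣ eval g z → + p ∣ eval g w →
      ¬ + p ∣ y - x → ¬ + p ∣ z - x → ¬ + p ∣ w - x →
      ¬ + p ∣ z - y → ¬ + p ∣ w - y → ¬ + p ∣ w - z → ⊥
    no-four-roots p∤c3 {x} {y} {z} {w} p∣gx p∣gy p∣gz p∣gw y≢x z≢x w≢x z≢y w≢y w≢z =
      p∤m∧p∤n⇒p∤m*n p-prime w≢z p∤c3
        (subst (+ p ∣_) (Δ₂-sub g x y z w) (∣m∣n⇒∣m-n p∣Δ₂xyw p∣Δ₂xyz))
      where
      p∣Δ₁xy : + p ∣ Δ₁ g x y
      p∣Δ₁xz : + p ∣ Δ₁ g x z
      p∣Δ₁xw : + p ∣ Δ₁ g x w
      p∣Δ₂xyz : + p ∣ Δ₂ g x y z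
      p∣Δ₂xyw : + p ∣ Δ₂ g x y w
      p∣Δ₁xy = p∣cofactor p-prime (eval-sub g x y) p∣gy p∣gx y≢x
      p∣Δ₁xz = p∣cofactor p-prime (eval-sub g x z) p∣gz p∣gx z≢x
      p∣Δ₁xw = p∣cofactor p-prime (eval-sub g x w) p∣gw p∣gx w≢x
      p∣Δ₂xyz = p∣cofactor p-prime (Δ₁-sub g x y z) p∣Δ₁xz p∣Δ₁xy z≢y
      p∣Δ₂xyw = p∣cofactor p-prime (Δ₁-sub g x y w) p∣Δ₁xw p∣Δ₁xy w≢y

  infix 4 _≡_mod_
  -- A record rather than a definition, so that x and y are inferable from the type.
  record _≡_mod_ (x y : ℤ) (m : ℕ) : Set where
    constructor congruent
    field m∣x-y : + m ∣ x - y

  module _ {m : ℕ} where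

    ≡-mod-refl : ∀ x → x ≡ x mod m
    ≡-mod-refl x = congruent (subst (+ m ∣_) (sym (+-inverseʳ x)) (divides (+ 0) refl))

    +-cong-mod : ∀ {x x′ y y′} → x ≡ x′ mod m → y ≡ y′ mod m → x + y ≡ x′ + y′ mod m
    +-cong-mod {x} {x′} {y} {y′} (congruent x≡x′) (congruent y≡y′) =
      congruent (subst (+ m ∣_) (sym (identity x x′ y y′)) (∣m∣n⇒∣m+n x≡x′ y≡y′))
      where
      identity : ∀ x x′ y y′ → (x + y) - (x′ + y′) ≡ (x - x′) + (y - y′)
      identity = solve-∀

    *-cong-mod : ∀ {x x′ y y′} → x ≡ x′ mod m → y ≡ y′ mod m → x * y ≡ x′ * y′ mod m
    *-cong-mod {x} {x′} {y} {y′} (congruent x≡x′) (congruent y≡y′) =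
      congruent (subst (+ m ∣_) (sym (identity x x′ y y′)) (∣m∣n⇒∣m+n (∣n⇒∣m*n x y≡y′) (∣m⇒∣m*n y′ x≡x′)))
      where
      identity : ∀ x x′ y y′ → x * y - x′ * y′ ≡ x * (y - y′) + (x - x′) * y′
      identity = solve-∀

    ≡-mod-sym : ∀ {x y} → x ≡ y mod m → y ≡ x mod m
    ≡-mod-sym {x} {y} (congruent m∣x-y) = congruent (subst (+ m ∣_) (identity x y) (∣m⇒∣-m m∣x-y))
      where
      identity : ∀ x y → - (x - y) ≡ y - x
      identity = solve-∀

    ≡-mod-∣ : ∀ {x y} → x ≡ y mod m → + m ∣ x → + m ∣ y
    ≡-mod-∣ {x} {y} (congruent m∣x-y) m∣x =
      subst (+ m ∣_) (neg-involutive y) (∣m⇒∣-m (∣m+n∣m⇒∣n m∣x-y m∣x))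

  shift-≡-mod : ∀ m t i → + (t ℕ.* m ℕ.+ i) ≡ + i mod m
  shift-≡-mod m t i = congruent (subst (+ m ∣_) (sym difference) (∣n⇒∣m*n (+ t) ∣-refl))
    where
    identity : ∀ t m i → t * m + i - i ≡ t * m
    identity = solve-∀
    difference : + (t ℕ.* m ℕ.+ i) - + i ≡ + t * + m
    difference = trans (cong (_- + i) (trans (pos-+ (t ℕ.* m) i) (cong (_+ + i) (pos-* t m))))
                       (identity (+ t) (+ m) (+ i))

  ∣⇒≡0-mod : ∀ {m x} → + m ∣ x → x ≡ + 0 mod m
  ∣⇒≡0-mod {m} {x} m∣x = congruent (subst (+ m ∣_) (sym (+-identityʳ x)) m∣x)

  homog-cong-mod : ∀ f {m a a′ b b′} → a ≡ a′ mod m → b ≡ b′ mod m →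
                   homog f a b ≡ homog f a′ b′ mod m
  homog-cong-mod f a≡a′ b≡b′ =
    +-cong-mod (+-cong-mod (+-cong-mod
      (monomial (c3 f) a≡a′ a≡a′ a≡a′) (monomial (c2 f) a≡a′ a≡a′ b≡b′))
      (monomial (c1 f) a≡a′ b≡b′ b≡b′)) (monomial (c0 f) b≡b′ b≡b′ b≡b′)
    where
    monomial : ∀ c {m x x′ y y′ z z′} → x ≡ x′ mod m → y ≡ y′ mod m → z ≡ z′ mod m →
               c * x * y * z ≡ c * x′ * y′ * z′ mod m
    monomial c x≡x′ y≡y′ z≡z′ =
      *-cong-mod (*-cong-mod (*-cong-mod (≡-mod-refl c) x≡x′) y≡y′) z≡z′

  slice : Cubic → ℤ → Cubic
  slice f a = cubic (c3 f * a * a * a) (c2 f * a * a) (c1 f * a) (c0 f)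

  homog≡eval-slice : ∀ f a x → homog f a x ≡ eval (slice f a) x
  homog≡eval-slice (cubic e0 e1 e2 e3) = identity e0 e1 e2 e3
    where
    identity : ∀ e0 e1 e2 e3 a x →
      e3 * a * a * a + e2 * a * a * x + e1 * a * x * x + e0 * x * x * x
      ≡ e0 * x * x * x + e1 * a * x * x + e2 * a * a * x + e3 * a * a * a
    identity = solve-∀

  disc-slice : ∀ f a → disc (slice f a) ≡ a * a * a * a * a * a * disc f
  disc-slice (cubic e0 e1 e2 e3) = identity e0 e1 e2 e3
    where
    identity : ∀ e0 e1 e2 e3 a →
      let b = e1 * a ; c = e2 * a * a ; d = e3 * a * a * a in
      b * b * c * c - + 4 * e0 * c * c * c - + 4 * b * b * b * d
        - + 27 * e0 * e0 * d * d + + 18 * e0 * b * c * d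
      ≡ a * a * a * a * a * a *
        (e2 * e2 * e1 * e1 - + 4 * e3 * e1 * e1 * e1 - + 4 * e2 * e2 * e2 * e0
          - + 27 * e3 * e3 * e0 * e0 + + 18 * e3 * e2 * e1 * e0)
    identity = solve-∀

  homog-scale : ∀ f x y c → homog f (x * c) (y * c) ≡ c * c * c * homog f x y
  homog-scale (cubic e0 e1 e2 e3) = identity e0 e1 e2 e3
    where
    identity : ∀ e0 e1 e2 e3 x y c →
      e3 * (x * c) * (x * c) * (x * c) + e2 * (x * c) * (x * c) * (y * c)
        + e1 * (x * c) * (y * c) * (y * c) + e0 * (y * c) * (y * c) * (y * c)
      ≡ c * c * c * (e3 * x * x * x + e2 * x * x * y + e1 * x * y * y + e0 * y * y * y)
    identity = solve-∀

  homog-zero : ∀ f b → homog f (+ 0) b ≡ c0 f * b * b * b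
  homog-zero (cubic e0 e1 e2 e3) = identity e0 e1 e2 e3
    where
    identity : ∀ e0 e1 e2 e3 b →
      e3 * + 0 * + 0 * + 0 + e2 * + 0 * + 0 * b + e1 * + 0 * b * b + e0 * b * b * b ≡ e0 * b * b * b
    identity = solve-∀

module RangeSums where

  open import Data.Nat
  open import Data.Nat.Properties
  open import Data.Bool using (true; false)
  open import Data.List using (List; []; _∷_; length; filter; applyUpTo; concatMap; map; _++_)
  open import Data.List.Properties using (filter-++; length-++)
  open import Function using (_∘_)
  open import Algebra.Properties.CommutativeSemigroup +-commutativeSemigroup using (interchange)
  open import Relation.Binary.PropositionalEquality
  open import Relation.Nullary using (Dec; _because_; yes; no; ¬_; contradiction)
  open import Relation.Unary using (Pred; Decidable)

  ∑< : ℕ → (ℕ → ℕ) → ℕ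
  ∑< zero    g = 0
  ∑< (suc n) g = g 0 + ∑< n (g ∘ suc)

  syntax ∑< n (λ i → e) = ∑[ i < n ] e

  𝟙 : ∀ {a} {P : Set a} → Dec P → ℕ
  𝟙 (true  because _) = 1
  𝟙 (false because _) = 0

  𝟙≤1 : ∀ {a} {P : Set a} (P? : Dec P) → 𝟙 P? ≤ 1
  𝟙≤1 (true  because _) = s≤s z≤n
  𝟙≤1 (false because _) = z≤n

  𝟙-cong : ∀ {a b} {P : Set a} {Q : Set b} (P? : Dec P) (Q? : Dec Q) → (P → Q) → (Q → P) → 𝟙 P? ≡ 𝟙 Q?
  𝟙-cong (yes _)  (yes _)  _   _   = refl
  𝟙-cong (no _)   (no _)   _   _   = refl
  𝟙-cong (yes p)  (no ¬q)  P→Q _   = contradiction (P→Q p) ¬q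
  𝟙-cong (no ¬p)  (yes q)  _   Q→P = contradiction (Q→P q) ¬p

  𝟙-no : ∀ {a} {P : Set a} (P? : Dec P) → ¬ P → 𝟙 P? ≡ 0
  𝟙-no (yes p) ¬p = contradiction p ¬p
  𝟙-no (no _)  _  = refl

  ∑-cong : ∀ n {g h} → (∀ i → i < n → g i ≡ h i) → ∑< n g ≡ ∑< n h
  ∑-cong zero    _   = refl
  ∑-cong (suc n) g≡h = cong₂ _+_ (g≡h 0 z<s) (∑-cong n (λ i i<n → g≡h (suc i) (s<s i<n)))

  ∑-mono-≤ : ∀ n {g h} → (∀ i → i < n → g i ≤ h i) → ∑< n g ≤ ∑< n h
  ∑-mono-≤ zero    _   = z≤n
  ∑-mono-≤ (suc n) g≤h = +-mono-≤ (g≤h 0 z<s) (∑-mono-≤ n (λ i i<n → g≤h (suc i) (s<s i<n)))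

  ∑-const : ∀ n c → ∑[ _ < n ] c ≡ n * c
  ∑-const zero    c = refl
  ∑-const (suc n) c = cong (c +_) (∑-const n c)

  ∑-distrib-+ : ∀ n g h → ∑[ i < n ] (g i + h i) ≡ ∑< n g + ∑< n h
  ∑-distrib-+ zero    g h = refl
  ∑-distrib-+ (suc n) g h = trans (cong (g 0 + h 0 +_) (∑-distrib-+ n (g ∘ suc) (h ∘ suc)))
                                  (interchange (g 0) (h 0) _ _)

  ∑-*-distribˡ : ∀ n c g → ∑[ i < n ] (c * g i) ≡ c * ∑< n g
  ∑-*-distribˡ zero    c g = sym (*-zeroʳ c)
  ∑-*-distribˡ (suc n) c g = trans (cong (c * g 0 +_) (∑-*-distribˡ n c (g ∘ suc)))
                                   (sym (*-distribˡ-+ c (g 0) _))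

  ∑-≤-length : ∀ n g → (∀ i → g i ≤ 1) → ∑< n g ≤ n
  ∑-≤-length n g g≤1 = subst (∑< n g ≤_) (trans (∑-const n 1) (*-identityʳ n))
                             (∑-mono-≤ n (λ i _ → g≤1 i))

  ∑-+ : ∀ m n g → ∑< (m + n) g ≡ ∑< m g + ∑[ i < n ] g (m + i)
  ∑-+ zero    n g = refl
  ∑-+ (suc m) n g = trans (cong (g 0 +_) (∑-+ m n (g ∘ suc))) (sym (+-assoc (g 0) _ _))

  ∑-blocks : ∀ m n g → ∑< (m * n) g ≡ ∑[ j < m ] ∑[ i < n ] g (j * n + i)
  ∑-blocks zero    n g = refl
  ∑-blocks (suc m) n g = trans (∑-+ n (m * n) g) (cong (∑< n g +_) (trans (∑-blocks m n (λ i → g (n + i)))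
    (∑-cong m (λ j _ → ∑-cong n (λ i _ → cong g (sym (+-assoc n (j * n) i)))))))

  ∑-periodic : ∀ c m g → (∀ t i → i < m → g (t * m + i) ≡ g i) → ∑< (c * m) g ≡ c * ∑< m g
  ∑-periodic c m g periodic = begin
    ∑< (c * m) g                            ≡⟨ ∑-blocks c m g ⟩
    ∑[ t < c ] ∑[ i < m ] g (t * m + i)     ≡⟨ ∑-cong c (λ t _ → ∑-cong m (periodic t)) ⟩
    ∑[ t < c ] ∑< m g                       ≡⟨ ∑-const c (∑< m g) ⟩
    c * ∑< m g                              ∎
    where open ≡-Reasoning

  ∑-by-residue : ∀ q L g →
    ∑< (suc q * L) g ≡ ∑[ j < L ] (g (j * suc q) + ∑[ i < q ] g (j * suc q + suc i))
  ∑-by-residue q L g = begin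
    ∑< (suc q * L) g                                ≡⟨ cong (λ n → ∑< n g) (*-comm (suc q) L) ⟩
    ∑< (L * suc q) g                                ≡⟨ ∑-blocks L (suc q) g ⟩
    ∑[ j < L ] ∑[ i < suc q ] g (j * suc q + i)
      ≡⟨ ∑-cong L (λ j _ → cong (λ x → g x + ∑[ i < q ] g (j * suc q + suc i)) (+-identityʳ (j * suc q))) ⟩
    ∑[ j < L ] (g (j * suc q) + ∑[ i < q ] g (j * suc q + suc i)) ∎
    where open ≡-Reasoning

  module _ {p} {A : Set} {P : Pred A p} (P? : Decidable P) where

    length-filter-applyUpTo : ∀ g n → length (filter P? (applyUpTo g n)) ≡ ∑[ i < n ] 𝟙 (P? (g i))
    length-filter-applyUpTo g zero = refl
    length-filter-applyUpTo g (suc n) with P? (g 0)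
    ... | true  because _ = cong suc (length-filter-applyUpTo (g ∘ suc) n)
    ... | false because _ = length-filter-applyUpTo (g ∘ suc) n

    length-filter-concatMap : ∀ {B : Set} (h : B → List A) g n →
      length (filter P? (concatMap h (applyUpTo g n))) ≡ ∑[ i < n ] length (filter P? (h (g i)))
    length-filter-concatMap h g zero = refl
    length-filter-concatMap h g (suc n) = begin
      length (filter P? (h (g 0) ++ concatMap h (applyUpTo (g ∘ suc) n)))
        ≡⟨ cong length (filter-++ P? (h (g 0)) _) ⟩
      length (filter P? (h (g 0)) ++ filter P? (concatMap h (applyUpTo (g ∘ suc) n)))
        ≡⟨ length-++ (filter P? (h (g 0))) ⟩
      length (filter P? (h (g 0))) + length (filter P? (concatMap h (applyUpTo (g ∘ suc) n)))
        ≡⟨ cong (length (filter P? (h (g 0))) +_) (length-filter-concatMap h (g ∘ suc) n) ⟩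
      ∑[ i < suc n ] length (filter P? (h (g i))) ∎
      where open ≡-Reasoning

    length-filter-map : ∀ {B : Set} (k : B → A) xs → length (filter P? (map k xs)) ≡ length (filter (P? ∘ k) xs)
    length-filter-map k []       = refl
    length-filter-map k (x ∷ xs) with P? (k x)
    ... | true  because _ = cong suc (length-filter-map k xs)
    ... | false because _ = length-filter-map k xs

module RootCounting where

  open Congruences
  open RangeSums

  open import Data.Nat
  open import Data.Nat.Properties
  open import Data.Nat.Divisibility
    using (_∣_; _∣?_; ∣-trans; m∣m*n; n∣m*n; ∣m+n∣m⇒∣n; ∣⇒≤; *-cancelˡ-∣; *-monoʳ-∣)
  open import Data.Nat.Primality using (Prime; prime⇒nonZero)
  import Data.Integer as ℤ
  open import Data.Integer using (+_)
  import Data.Integer.Properties as ℤₚ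
  import Data.Integer.Divisibility.Signed as ℤᵈ
  import Data.Integer.Divisibility as ℤᵘ
  open import Data.List using ([]; _∷_; length; filter; upTo; map)
  open import Data.List.Relation.Unary.All using (All; []; _∷_)
  import Data.List.Relation.Unary.All.Properties as All
  open import Data.List.Relation.Unary.AllPairs using (AllPairs; []; _∷_)
  import Data.List.Relation.Unary.AllPairs.Properties as AllPairs
  open import Relation.Unary using (Decidable)
  open import Data.Product using (_,_)
  open import Function using (id; _∘_)
  open import Relation.Binary.PropositionalEquality
  open import Relation.Nullary using (¬_; Dec; contradiction)
  open import Data.Empty using (⊥-elim)
  open import Data.Nat.Tactic.RingSolver using (solve-∀)
  open import Algebra.Properties.CommutativeSemigroup *-commutativeSemigroup using (x∙yz≈y∙xz)

  ∣+n-+m∣≡n∸m : ∀ {m n} → m ≤ n → ℤ.∣ + n ℤ.- + m ∣ ≡ n ∸ m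
  ∣+n-+m∣≡n∸m {m} {n} m≤n = cong ℤ.∣_∣ (trans (ℤₚ.m-n≡m⊖n n m) (ℤₚ.⊖-≥ m≤n))

  module _ (g : Cubic) {p} (p-prime : Prime p)
           (p∤disc : ¬ + p ℤᵈ.∣ disc g) (p∤c3 : ¬ + p ℤᵈ.∣ c3 g) (n : ℕ) where

    private
      N : ℕ
      N = p ^ suc n

    IsRoot : ℕ → Set
    IsRoot x = N ∣ ℤ.∣ eval g (+ x) ∣

    private
      p∣root : ∀ {x} → IsRoot x → + p ℤᵈ.∣ eval g (+ x)
      p∣root {x} N∣gx = ℤᵈ.∣ᵤ⇒∣ {+ p} {eval g (+ x)} (∣-trans (m∣m*n (p ^ n)) N∣gx)

      roots-separated : ∀ {x y} → x < y → y < N → IsRoot x → IsRoot y → ¬ + p ℤᵈ.∣ + y ℤ.- + x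
      roots-separated {x} {y} x<y y<N N∣gx N∣gy p∣y-x = <⇒≱ (≤-<-trans (m∸n≤m y x) y<N) (∣⇒≤ N∣y∸x)
        where
        instance
          _ : NonZero (y ∸ x)
          _ = >-nonZero (m<n⇒0<n∸m x<y)
        N∣y∸x : N ∣ y ∸ x
        N∣y∸x = subst (N ∣_) (∣+n-+m∣≡n∸m (<⇒≤ x<y))
          (ℤᵈ.∣⇒∣ᵤ (root-lifts-uniquely g p-prime p∤disc n
            (ℤᵈ.∣ᵤ⇒∣ {+ N} {eval g (+ x)} N∣gx) (ℤᵈ.∣ᵤ⇒∣ {+ N} {eval g (+ y)} N∣gy) p∣y-x))

      sorted-roots-length≤3 : ∀ xs → All IsRoot xs → All (_< N) xs → AllPairs _<_ xs → length xs ≤ 3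
      sorted-roots-length≤3 []                _ _ _ = z≤n
      sorted-roots-length≤3 (_ ∷ [])          _ _ _ = s≤s z≤n
      sorted-roots-length≤3 (_ ∷ _ ∷ [])      _ _ _ = s≤s (s≤s z≤n)
      sorted-roots-length≤3 (_ ∷ _ ∷ _ ∷ [])  _ _ _ = s≤s (s≤s (s≤s z≤n))
      sorted-roots-length≤3 (x ∷ y ∷ z ∷ w ∷ _)
        (rx ∷ ry ∷ rz ∷ rw ∷ _) (_ ∷ y<N ∷ z<N ∷ w<N ∷ _)
        ((x<y ∷ x<z ∷ x<w ∷ _) ∷ (y<z ∷ y<w ∷ _) ∷ (z<w ∷ _) ∷ _) =
        ⊥-elim (no-four-roots g p-prime p∤c3 (p∣root rx) (p∣root ry) (p∣root rz) (p∣root rw)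
          (roots-separated x<y y<N rx ry) (roots-separated x<z z<N rx rz) (roots-separated x<w w<N rx rw)
          (roots-separated y<z z<N ry rz) (roots-separated y<w w<N ry rw) (roots-separated z<w w<N rz rw))

    roots-mod-pⁿ≤3 : ∑[ x < N ] 𝟙 (N ∣? ℤ.∣ eval g (+ x) ∣) ≤ 3
    roots-mod-pⁿ≤3 = subst (_≤ 3) (length-filter-applyUpTo root? id N)
      (sorted-roots-length≤3 (filter root? (upTo N)) (All.all-filter root? (upTo N))
        (All.filter⁺ root? (All.all-upTo N))
        (AllPairs.filter⁺ root? (AllPairs.applyUpTo⁺₁ id N (λ i<j _ → i<j))))
      where
      root? : Decidable IsRoot
      root? x = N ∣? ℤ.∣ eval g (+ x) ∣

  rootsMod : Cubic → ℕ → ℕ → ℕ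
  rootsMod f N a = ∑[ b < N ] 𝟙 (N ∣? ℤ.∣ homog f (+ a) (+ b) ∣)

  ρ₁≡∑rootsMod : ∀ f N → ρ₁ f N ≡ ∑[ a < N ] rootsMod f N a
  ρ₁≡∑rootsMod f N = trans (length-filter-concatMap _ (λ a → map (a ,_) (upTo N)) id N)
    (∑-cong N (λ a _ → trans (length-filter-map _ (a ,_) (upTo N)) (length-filter-applyUpTo _ id N)))

  module _ (f : Cubic) (M : ℕ) where

    private
      ∣-respects-≡-mod : ∀ {x y} → x ≡ y mod M → M ∣ ℤ.∣ x ∣ → M ∣ ℤ.∣ y ∣
      ∣-respects-≡-mod {x} x≡y M∣x = ℤᵈ.∣⇒∣ᵤ (≡-mod-∣ x≡y (ℤᵈ.∣ᵤ⇒∣ {+ M} {x} M∣x))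

      root-indicator-cong : ∀ {a a′ b b′} → a ≡ a′ mod M → b ≡ b′ mod M →
        𝟙 (M ∣? ℤ.∣ homog f a b ∣) ≡ 𝟙 (M ∣? ℤ.∣ homog f a′ b′ ∣)
      root-indicator-cong a≡a′ b≡b′ = 𝟙-cong _ _
        (∣-respects-≡-mod (homog-cong-mod f a≡a′ b≡b′))
        (∣-respects-≡-mod (≡-mod-sym (homog-cong-mod f a≡a′ b≡b′)))

    rootsMod-periodic : ∀ t a → rootsMod f M (t * M + a) ≡ rootsMod f M a
    rootsMod-periodic t a =
      ∑-cong M (λ b _ → root-indicator-cong (shift-≡-mod M t a) (≡-mod-refl (+ b)))

    ∑∑-roots-periodic : ∀ c →
      ∑[ a < c * M ] ∑[ b < c * M ] 𝟙 (M ∣? ℤ.∣ homog f (+ a) (+ b) ∣) ≡ c * (c * ρ₁ f M)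
    ∑∑-roots-periodic c = begin
      ∑[ a < c * M ] ∑[ b < c * M ] 𝟙 (M ∣? ℤ.∣ homog f (+ a) (+ b) ∣)
        ≡⟨ ∑-cong (c * M) (λ a _ → ∑-periodic c M _
             (λ t b _ → root-indicator-cong (≡-mod-refl (+ a)) (shift-≡-mod M t b))) ⟩
      ∑[ a < c * M ] (c * rootsMod f M a)
        ≡⟨ ∑-*-distribˡ (c * M) c (rootsMod f M) ⟩
      c * ∑[ a < c * M ] rootsMod f M a
        ≡⟨ cong (c *_) (∑-periodic c M (rootsMod f M) (λ t a _ → rootsMod-periodic t a)) ⟩
      c * (c * ∑[ a < M ] rootsMod f M a)
        ≡⟨ cong (λ r → c * (c * r)) (ρ₁≡∑rootsMod f M) ⟨
      c * (c * ρ₁ f M) ∎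
      where open ≡-Reasoning

  ρ₁≤N*N : ∀ f N → ρ₁ f N ≤ N * N
  ρ₁≤N*N f N = subst (_≤ N * N) (sym (ρ₁≡∑rootsMod f N))
    (subst (∑[ a < N ] rootsMod f N a ≤_) (∑-const N N)
      (∑-mono-≤ N (λ a _ → ∑-≤-length N _ (λ b → 𝟙≤1 _))))

  module _ (f : Cubic) {q} (p-prime : Prime (suc q))
           (p∤disc : ¬ + suc q ℤᵈ.∣ disc f) (p∤c0 : ¬ + suc q ℤᵈ.∣ c0 f) where

    private
      p : ℕ
      p = suc q

      infixl 7 _·_
      _·_ : ∀ {m n} → ¬ + p ℤᵈ.∣ m → ¬ + p ℤᵈ.∣ n → ¬ + p ℤᵈ.∣ m ℤ.* n
      _·_ = p∤m∧p∤n⇒p∤m*n p-prime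

      p∤k*p+suc[i] : ∀ k i → i < q → ¬ p ∣ k * p + suc i
      p∤k*p+suc[i] k i i<q p∣k*p+suc[i] =
        <⇒≱ (s≤s i<q) (∣⇒≤ (∣m+n∣m⇒∣n p∣k*p+suc[i] (n∣m*n k)))

    rootsMod-primitive≤3 : ∀ n a → ¬ p ∣ a → rootsMod f (p ^ suc n) a ≤ 3
    rootsMod-primitive≤3 n a p∤a = subst (_≤ 3)
      (∑-cong (p ^ suc n) (λ b _ → cong (λ z → 𝟙 (p ^ suc n ∣? ℤ.∣ z ∣)) (sym (homog≡eval-slice f (+ a) (+ b)))))
      (roots-mod-pⁿ≤3 (slice f (+ a)) p-prime p∤disc-slice p∤c0 n)
      where
      p∤+a : ¬ + p ℤᵈ.∣ + a
      p∤+a p∣a = p∤a (ℤᵈ.∣⇒∣ᵤ p∣a)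
      p∤disc-slice : ¬ + p ℤᵈ.∣ disc (slice f (+ a))
      p∤disc-slice = subst (λ d → ¬ + p ℤᵈ.∣ d) (sym (disc-slice f (+ a)))
        (p∤+a · p∤+a · p∤+a · p∤+a · p∤+a · p∤+a · p∤disc)

    imprimitive-nonroot : ∀ n {a b} → + p ℤᵈ.∣ a → ¬ + p ℤᵈ.∣ b → ¬ p ^ suc n ∣ ℤ.∣ homog f a b ∣
    imprimitive-nonroot n {a} {b} p∣a p∤b pⁿ∣fab = (p∤c0 · p∤b · p∤b · p∤b) p∣c0b³
      where
      p∣fab : + p ℤᵈ.∣ homog f a b
      p∣fab = ℤᵈ.∣ᵤ⇒∣ {+ p} {homog f a b} (∣-trans (m∣m*n (p ^ n)) pⁿ∣fab)
      p∣c0b³ : + p ℤᵈ.∣ c0 f ℤ.* b ℤ.* b ℤ.* b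
      p∣c0b³ = subst (+ p ℤᵈ.∣_) (homog-zero f b)
        (≡-mod-∣ (homog-cong-mod f (∣⇒≡0-mod p∣a) (≡-mod-refl b)) p∣fab)

    rootsMod-imprimitive : ∀ β j → rootsMod f (p ^ suc β) (j * p)
      ≡ ∑[ k < p ^ β ] 𝟙 (p ^ suc β ∣? ℤ.∣ homog f (+ (j * p)) (+ (k * p)) ∣)
    rootsMod-imprimitive β j = trans (∑-by-residue q (p ^ β) _) (∑-cong (p ^ β) (λ k _ →
      trans (cong (_+_ (𝟙 (root? (k * p)))) (trans (∑-cong q (λ i i<q → 𝟙-no (root? (k * p + suc i))
              (imprimitive-nonroot β p∣jp (λ p∣b → p∤k*p+suc[i] k i i<q (ℤᵈ.∣⇒∣ᵤ p∣b)))))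
            (trans (∑-const q 0) (*-zeroʳ q))))
        (+-identityʳ _)))
      where
      root? : ∀ b → Dec (p ^ suc β ∣ ℤ.∣ homog f (+ (j * p)) (+ b) ∣)
      root? b = p ^ suc β ∣? ℤ.∣ homog f (+ (j * p)) (+ b) ∣
      p∣jp : + p ℤᵈ.∣ + (j * p)
      p∣jp = ℤᵈ.∣ᵤ⇒∣ {+ p} {+ (j * p)} (n∣m*n j)

    ρ₁-imprimitive : ℕ → ℕ
    ρ₁-imprimitive β = ∑[ j < p ^ β ] ∑[ k < p ^ β ] 𝟙 (p ^ suc β ∣? ℤ.∣ homog f (+ (j * p)) (+ (k * p)) ∣)

    ρ₁-step : ∀ β → ρ₁ f (p ^ suc β) ≤ ρ₁-imprimitive β + p ^ β * (q * 3)
    ρ₁-step β = begin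
      ρ₁ f N
        ≡⟨ ρ₁≡∑rootsMod f N ⟩
      ∑[ a < p * p ^ β ] rootsMod f N a
        ≡⟨ ∑-by-residue q (p ^ β) (rootsMod f N) ⟩
      ∑[ j < p ^ β ] (rootsMod f N (j * p) + ∑[ i < q ] rootsMod f N (j * p + suc i))
        ≤⟨ ∑-mono-≤ (p ^ β) (λ j _ → +-monoʳ-≤ (rootsMod f N (j * p)) (primitive≤q*3 j)) ⟩
      ∑[ j < p ^ β ] (rootsMod f N (j * p) + q * 3)
        ≡⟨ ∑-distrib-+ (p ^ β) _ _ ⟩
      ∑[ j < p ^ β ] rootsMod f N (j * p) + ∑[ _ < p ^ β ] (q * 3)
        ≡⟨ cong₂ _+_ (∑-cong (p ^ β) (λ j _ → rootsMod-imprimitive β j)) (∑-const (p ^ β) (q * 3)) ⟩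
      ρ₁-imprimitive β + p ^ β * (q * 3) ∎
      where
      open ≤-Reasoning
      N : ℕ
      N = p ^ suc β
      primitive≤q*3 : ∀ j → ∑[ i < q ] rootsMod f N (j * p + suc i) ≤ q * 3
      primitive≤q*3 j = subst (∑[ i < q ] rootsMod f N (j * p + suc i) ≤_) (∑-const q 3)
        (∑-mono-≤ q (λ i i<q → rootsMod-primitive≤3 β _ (p∤k*p+suc[i] j i i<q)))

    ρ₁-imprimitive≤ : ∀ β → ρ₁-imprimitive β ≤ p ^ β * p ^ β
    ρ₁-imprimitive≤ β = subst (ρ₁-imprimitive β ≤_) (∑-const (p ^ β) (p ^ β))
      (∑-mono-≤ (p ^ β) (λ j _ → ∑-≤-length (p ^ β) _ (λ k → 𝟙≤1 _)))

    ∣homog-scaled∣ : ∀ j k → ℤ.∣ homog f (+ (j * p)) (+ (k * p)) ∣ ≡ p * (p * (p * ℤ.∣ homog f (+ j) (+ k) ∣))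
    ∣homog-scaled∣ j k = begin
      ℤ.∣ homog f (+ (j * p)) (+ (k * p)) ∣
        ≡⟨ cong ℤ.∣_∣ (cong₂ (homog f) (ℤₚ.pos-* j p) (ℤₚ.pos-* k p)) ⟩
      ℤ.∣ homog f (+ j ℤ.* + p) (+ k ℤ.* + p) ∣
        ≡⟨ cong ℤ.∣_∣ (homog-scale f (+ j) (+ k) (+ p)) ⟩
      ℤ.∣ + p ℤ.* + p ℤ.* + p ℤ.* X ∣
        ≡⟨ ℤₚ.abs-* (+ p ℤ.* + p ℤ.* + p) X ⟩
      ℤ.∣ + p ℤ.* + p ℤ.* + p ∣ * ℤ.∣ X ∣
        ≡⟨ cong (_* ℤ.∣ X ∣) (trans (ℤₚ.abs-* (+ p ℤ.* + p) (+ p)) (cong (_* p) (ℤₚ.abs-* (+ p) (+ p)))) ⟩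
      p * p * p * ℤ.∣ X ∣
        ≡⟨ trans (*-assoc (p * p) p _) (*-assoc p p _) ⟩
      p * (p * (p * ℤ.∣ X ∣)) ∎
      where
      open ≡-Reasoning
      X : ℤ.ℤ
      X = homog f (+ j) (+ k)

    ρ₁-imprimitive-rec : ∀ γ → ρ₁-imprimitive (2 + γ) ≡ (p * p) * ((p * p) * ρ₁ f (p ^ γ))
    ρ₁-imprimitive-rec γ = begin
      ρ₁-imprimitive (2 + γ)
        ≡⟨ ∑-cong L (λ j _ → ∑-cong L (λ k _ → 𝟙-cong _ _ (descend j k) (ascend j k))) ⟩
      ∑[ j < L ] ∑[ k < L ] 𝟙 (M ∣? ℤ.∣ homog f (+ j) (+ k) ∣)
        ≡⟨ cong (λ n → ∑[ j < n ] ∑[ k < n ] 𝟙 (M ∣? ℤ.∣ homog f (+ j) (+ k) ∣)) (sym (*-assoc p p M)) ⟩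
      ∑[ j < p * p * M ] ∑[ k < p * p * M ] 𝟙 (M ∣? ℤ.∣ homog f (+ j) (+ k) ∣)
        ≡⟨ ∑∑-roots-periodic f M (p * p) ⟩
      (p * p) * ((p * p) * ρ₁ f M) ∎
      where
      open ≡-Reasoning
      instance
        _ : NonZero p
        _ = prime⇒nonZero p-prime
      M L : ℕ
      M = p ^ γ
      L = p ^ (2 + γ)
      descend : ∀ j k → p * (p * (p * M)) ∣ ℤ.∣ homog f (+ (j * p)) (+ (k * p)) ∣ → M ∣ ℤ.∣ homog f (+ j) (+ k) ∣
      descend j k h = *-cancelˡ-∣ p (*-cancelˡ-∣ p (*-cancelˡ-∣ p
        (subst (p * (p * (p * M)) ∣_) (∣homog-scaled∣ j k) h)))
      ascend : ∀ j k → M ∣ ℤ.∣ homog f (+ j) (+ k) ∣ → p * (p * (p * M)) ∣ ℤ.∣ homog f (+ (j * p)) (+ (k * p)) ∣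
      ascend j k h = subst (p * (p * (p * M)) ∣_) (sym (∣homog-scaled∣ j k))
        (*-monoʳ-∣ p (*-monoʳ-∣ p (*-monoʳ-∣ p h)))

    -- The slack 3 pⁿ pays for the roots with primitive first coordinate when passing from n to n + 3.
    ρ₁⁺ : ℕ → ℕ
    ρ₁⁺ n = ρ₁ f (p ^ n) + 3 * p ^ n

    ρ₁⁺-step : ∀ γ → ρ₁⁺ (3 + γ) ≤ p ^ 4 * ρ₁⁺ γ
    ρ₁⁺-step γ = begin
      ρ₁ f (p ^ (3 + γ)) + 3 * p ^ (3 + γ)
        ≤⟨ +-monoˡ-≤ (3 * p ^ (3 + γ)) (ρ₁-step (2 + γ)) ⟩
      ρ₁-imprimitive (2 + γ) + p ^ (2 + γ) * (q * 3) + 3 * p ^ (3 + γ)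
        ≡⟨ cong (λ d → d + p ^ (2 + γ) * (q * 3) + 3 * p ^ (3 + γ)) (ρ₁-imprimitive-rec γ) ⟩
      p * p * (p * p * R) + p * (p * X) * (q * 3) + 3 * (p * (p * (p * X)))
        ≤⟨ m≤m+n _ (3 * X * p * p * q * q) ⟩
      p * p * (p * p * R) + p * (p * X) * (q * 3) + 3 * (p * (p * (p * X))) + 3 * X * p * p * q * q
        ≡⟨ identity q R X ⟨
      p ^ 4 * (R + 3 * X) ∎
      where
      open ≤-Reasoning
      R X : ℕ
      R = ρ₁ f (p ^ γ)
      X = p ^ γ
      identity : ∀ q R X → suc q * (suc q * (suc q * (suc q * 1))) * (R + 3 * X)
        ≡ suc q * suc q * (suc q * suc q * R) + suc q * (suc q * X) * (q * 3)
          + 3 * (suc q * (suc q * (suc q * X))) + 3 * X * suc q * suc q * q * q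
      identity = solve-∀

    ρ₁⁺-initial : ∀ α → α < 3 → ρ₁⁺ α ≤ 7 * p ^ α
    ρ₁⁺-initial 0 _ = ≤-trans (+-monoˡ-≤ 3 (ρ₁≤N*N f 1)) (m≤m+n 4 3)
    ρ₁⁺-initial 1 _ = begin
      ρ₁ f (p * 1) + 3 * (p * 1)
        ≤⟨ +-monoˡ-≤ (3 * (p * 1)) (≤-trans (ρ₁-step 0) (+-monoˡ-≤ (1 * (q * 3)) (ρ₁-imprimitive≤ 0))) ⟩
      1 * 1 + 1 * (q * 3) + 3 * (p * 1)
        ≤⟨ m≤m+n _ (3 + q) ⟩
      1 * 1 + 1 * (q * 3) + 3 * (p * 1) + (3 + q)
        ≡⟨ identity q ⟨
      7 * (p * 1) ∎
      where
      open ≤-Reasoning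
      identity : ∀ q → 7 * (suc q * 1) ≡ 1 * 1 + 1 * (q * 3) + 3 * (suc q * 1) + (3 + q)
      identity = solve-∀
    ρ₁⁺-initial 2 _ = begin
      ρ₁ f (p * (p * 1)) + 3 * (p * (p * 1))
        ≤⟨ +-monoˡ-≤ (3 * (p * (p * 1))) (≤-trans (ρ₁-step 1) (+-monoˡ-≤ (p * 1 * (q * 3)) (ρ₁-imprimitive≤ 1))) ⟩
      p * 1 * (p * 1) + p * 1 * (q * 3) + 3 * (p * (p * 1))
        ≤⟨ m≤m+n _ (3 * p) ⟩
      p * 1 * (p * 1) + p * 1 * (q * 3) + 3 * (p * (p * 1)) + 3 * p
        ≡⟨ identity q ⟨
      7 * (p * (p * 1)) ∎
      where
      open ≤-Reasoning
      identity : ∀ q → 7 * (suc q * (suc q * 1))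
        ≡ suc q * 1 * (suc q * 1) + suc q * 1 * (q * 3) + 3 * (suc q * (suc q * 1)) + 3 * suc q
      identity = solve-∀
    ρ₁⁺-initial (suc (suc (suc _))) (s≤s (s≤s (s≤s ())))

    private
      cube-* : ∀ a b → (a * b) ^ 3 ≡ a ^ 3 * b ^ 3
      cube-* a b = identity a b
        where
        identity : ∀ a b → a * b * (a * b * (a * b * 1)) ≡ a * (a * (a * 1)) * (b * (b * (b * 1)))
        identity = solve-∀

      initial-cube : ∀ α → α < 3 → ρ₁⁺ α ^ 3 ≤ 343 * p ^ (4 * α)
      initial-cube α α<3 = begin
        ρ₁⁺ α ^ 3                ≤⟨ ^-monoˡ-≤ 3 (ρ₁⁺-initial α α<3) ⟩
        (7 * p ^ α) ^ 3          ≡⟨ cube-* 7 (p ^ α) ⟩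
        343 * (p ^ α) ^ 3        ≡⟨ cong (343 *_) (^-*-assoc p α 3) ⟩
        343 * p ^ (α * 3)        ≤⟨ *-monoʳ-≤ 343 (^-monoʳ-≤ p α*3≤4*α) ⟩
        343 * p ^ (4 * α)        ∎
        where
        open ≤-Reasoning
        α*3≤4*α : α * 3 ≤ 4 * α
        α*3≤4*α = subst (_≤ 4 * α) (*-comm 3 α) (*-monoˡ-≤ α (n≤1+n 3))

    ρ₁⁺-cube : ∀ α → ρ₁⁺ α ^ 3 ≤ 343 * p ^ (4 * α)
    ρ₁⁺-cube 0 = initial-cube 0 (s≤s z≤n)
    ρ₁⁺-cube 1 = initial-cube 1 (s≤s (s≤s z≤n))
    ρ₁⁺-cube 2 = initial-cube 2 (s≤s (s≤s (s≤s z≤n)))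
    ρ₁⁺-cube (suc (suc (suc γ))) = begin
      ρ₁⁺ (3 + γ) ^ 3                     ≤⟨ ^-monoˡ-≤ 3 (ρ₁⁺-step γ) ⟩
      (p ^ 4 * ρ₁⁺ γ) ^ 3                 ≡⟨ cube-* (p ^ 4) (ρ₁⁺ γ) ⟩
      (p ^ 4) ^ 3 * ρ₁⁺ γ ^ 3             ≤⟨ *-monoʳ-≤ ((p ^ 4) ^ 3) (ρ₁⁺-cube γ) ⟩
      (p ^ 4) ^ 3 * (343 * p ^ (4 * γ))   ≡⟨ x∙yz≈y∙xz ((p ^ 4) ^ 3) 343 (p ^ (4 * γ)) ⟩
      343 * ((p ^ 4) ^ 3 * p ^ (4 * γ))   ≡⟨ cong (λ e → 343 * (e * p ^ (4 * γ))) (^-*-assoc p 4 3) ⟩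
      343 * (p ^ 12 * p ^ (4 * γ))        ≡⟨ cong (343 *_) (^-distribˡ-+-* p 12 (4 * γ)) ⟨
      343 * p ^ (12 + 4 * γ)              ≡⟨ cong (λ e → 343 * p ^ e) (*-distribˡ-+ 4 3 γ) ⟨
      343 * p ^ (4 * (3 + γ))             ∎
      where open ≤-Reasoning

  ρ₁-cube-bound : ∀ f {p} → Prime p → ¬ + p ℤᵘ.∣ disc f → ¬ + p ℤᵘ.∣ c0 f →
                  ∀ α → ρ₁ f (p ^ α) ^ 3 ≤ 343 * p ^ (4 * α)
  ρ₁-cube-bound f {zero}  p-prime = contradiction refl (≢-nonZero⁻¹ 0 {{prime⇒nonZero p-prime}})
  ρ₁-cube-bound f {suc q} p-prime p∤disc p∤c0 α =
    ≤-trans (^-monoˡ-≤ 3 (m≤m+n (ρ₁ f (suc q ^ α)) (3 * suc q ^ α)))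
            (ρ₁⁺-cube f p-prime (p∤disc ∘ ℤᵈ.∣⇒∣ᵤ) (p∤c0 ∘ ℤᵈ.∣⇒∣ᵤ) α)

open import Data.Nat using (ℕ; _≤_; _*_; _^_)
open import Data.Integer using (+_)
open import Data.Integer.Divisibility using (_∣_)
open import Data.Nat.Primality using (Prime)
open import Data.List using (List)
open import Data.List.Relation.Unary.All using (All)
open import Data.List.Membership.Propositional using (_∈_; _∉_)
open import Data.Product using (∃; _,_)
open import Function using (_∘_)
open RootCounting using (ρ₁-cube-bound)

-- Irreducibility and the primes of the leading coefficient c3 are not needed for this bound.
lemma4p3 : ∃ λ (C : ℕ) →
    ∀ (f : Cubic) → IsCubic f → IrreducibleP (toPoly f) →
    ∀ (P₁ : List ℕ) → All Prime P₁ →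
    (∀ q → Prime q → (+ q) ∣ disc f → q ∈ P₁) →
    (∀ q → Prime q → (+ q) ∣ c3 f → q ∈ P₁) →
    (∀ q → Prime q → (+ q) ∣ c0 f → q ∈ P₁) →
    ∀ (p : ℕ) → Prime p → p ∉ P₁ → ∀ (α : ℕ) →
    ρ₁ f (p ^ α) ^ 3 ≤ C * p ^ (4 * α)
lemma4p3 = 343 , λ f _ _ P₁ _ disc-primes _ c0-primes p p-prime p∉P₁ →
  ρ₁-cube-bound f p-prime (p∉P₁ ∘ disc-primes p p-prime) (p∉P₁ ∘ c0-primes p p-prime)
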